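{- Let $p$ be a prime and let $R$ be a finite commutative local ring with maximal ideal $M$ whose residue field $R/M$ has characteristic different from $p$, with $-1\in (R^{\times})^p$. Then $M$ is a homogeneous set in $G_R(p)$. As a result, if $G_R(p)$ is prime, then $R$ is a field.
   Context: $(R^{\times})^p=\{u^p:u\in R^{\times}\}$, assumed to contain $-1$. $G_R(p)$ is the simple undirected graph with vertex set $R$ in which $a,b$ are adjacent iff $a-b\in (R^{\times})^p$. A homogeneous set in a graph $G$ is a set $X\subseteq V(G)$ such that every vertex outside $X$ is adjacent to all or none of the vertices of $X$; it is non-trivial if $2\le |X|<|V(G)|$. A graph is prime if it has no non-trivial homogeneous set. -}

module Defs where

open import Level using (Level; _⊔_; suc)
open import Algebra.Bundles using (CommutativeRing; Semiring)
open import Data.Nat using (ℕ; _<_)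
open import Data.Fin using (Fin)
open import Data.Product using (Σ; ∃; ∃-syntax; _×_; _,_)
open import Data.Sum using (_⊎_)
open import Relation.Nullary using (¬_)
open import Relation.Binary using (Setoid; Rel)
open import Relation.Unary using (Pred)

module GraphNotions {v e : Level} (V : Setoid v e) {r : Level} (Adj : Rel (Setoid.Carrier V) r) where
  open Setoid V renaming (Carrier to Vx)

  Respects≈ : ∀ {s} → Pred Vx s → Set (v ⊔ e ⊔ s)
  Respects≈ X = ∀ {x y} → x ≈ y → X x → X y

  IsHomogeneous : ∀ {s} → Pred Vx s → Set (v ⊔ r ⊔ s)
  IsHomogeneous X = ∀ w → ¬ X w →
    (∀ x → X x → Adj w x) ⊎ (∀ x → X x → ¬ Adj w x)

  IsNonTrivial : ∀ {s} → Pred Vx s → Set (v ⊔ e ⊔ s)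
  IsNonTrivial X = (∃[ x ] ∃[ y ] (X x × X y × ¬ (x ≈ y))) × (∃[ w ] ¬ X w)

  IsPrimeGraph : Set (suc (v ⊔ e) ⊔ r)
  IsPrimeGraph = (X : Pred Vx (v ⊔ e)) → Respects≈ X → IsHomogeneous X → ¬ IsNonTrivial X

module RingNotions {c ℓ : Level} (R : CommutativeRing c ℓ) where
  open CommutativeRing R
  open import Algebra.Definitions.RawSemiring (Semiring.rawSemiring semiring) using (_^_) renaming (_×_ to _·ℕ_) public

  IsUnit : Carrier → Set (c ⊔ ℓ)
  IsUnit x = ∃[ y ] (x * y ≈ 1#)

  IsFinite : Set (c ⊔ ℓ)
  IsFinite = ∃[ n ] Σ (Fin n → Carrier) (λ f → ∀ x → ∃[ i ] (f i ≈ x))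

  IsField : Set (c ⊔ ℓ)
  IsField = ¬ (1# ≈ 0#) × (∀ x → ¬ (x ≈ 0#) → IsUnit x)

  record IsIdeal (I : Pred Carrier (c ⊔ ℓ)) : Set (c ⊔ ℓ) where
    field
      resp  : ∀ {x y} → x ≈ y → I x → I y
      has0  : I 0#
      +-closed : ∀ {x y} → I x → I y → I (x + y)
      *-closed : ∀ r {x} → I x → I (r * x)

  record IsMaximalIdeal (M : Pred Carrier (c ⊔ ℓ)) : Set (suc (c ⊔ ℓ)) where
    field
      isIdeal : IsIdeal M
      proper  : ¬ M 1#
      maximal : (J : Pred Carrier (c ⊔ ℓ)) → IsIdeal J → (∀ x → M x → J x) →
                (∀ x → J x → M x) ⊎ (∀ x → J x)

  IsLocal : Set (suc (c ⊔ ℓ))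
  IsLocal = ∃[ M ] (IsMaximalIdeal M ×
    ((N : Pred Carrier (c ⊔ ℓ)) → IsMaximalIdeal N → (∀ x → N x → M x) × (∀ x → M x → N x)))

  ResidueCharIs : Pred Carrier (c ⊔ ℓ) → ℕ → Set (c ⊔ ℓ)
  ResidueCharIs M q = (0 < q) × M (q ·ℕ 1#) × (∀ k → 0 < k → k < q → ¬ M (k ·ℕ 1#))

  MinusOneIsPthPower : ℕ → Set (c ⊔ ℓ)
  MinusOneIsPthPower p = ∃[ u ] (IsUnit u × (u ^ p ≈ - 1#))

  Adj : ℕ → Rel Carrier (c ⊔ ℓ)
  Adj p a b = ∃[ u ] (IsUnit u × (u ^ p ≈ a - b))

  module G (p : ℕ) = GraphNotions setoid (Adj p)

{-# OPTIONS --safe #-}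
-- Outside M everything is a unit (R is finite and local), and p·1 ∉ M because the residue
-- characteristic is not p. So the p-th power map is injective on 1 + M, as uᵖ - vᵖ = (u - v)·S with
-- S ≡ p (mod M) a unit, hence bijective, R being finite. If w - x = uᵖ with u a unit and x, y ∈ M,
-- then w - y = uᵖ·(1 + u⁻ᵖ(x - y)) is again the p-th power of a unit: w is adjacent to all of M or
-- to none of it. A prime G_R(p) then leaves no room for M ≠ 0, i.e. R is a field.
module Submission where

open import Defs
open import Level using (Level; 0ℓ; _⊔_)
open import Algebra.Bundles using (CommutativeRing; RawRing)
open import Algebra.Solver.Ring.AlmostCommutativeRing using (_-Raw-AlmostCommutative⟶_; fromCommutativeRing)
open import Axiom.ExcludedMiddle using (ExcludedMiddle)
open import Data.Empty using (⊥-elim)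
open import Data.Fin using (Fin; zero; suc; toℕ)
open import Data.Fin.Properties using (pigeonhole)
open import Data.Maybe using (just; nothing)
open import Data.Nat as ℕ using (ℕ; zero; suc; s≤s)
open import Data.Nat.Coprimality using (Coprime; coprime-Bézout; prime⇒coprime)
open import Data.Nat.GCD using (module Bézout)
open import Data.Nat.GeneralisedArithmetic using (fold)
open import Data.Nat.Primality using (Prime; prime⇒nonZero)
open import Data.Nat.Properties using (n<1+n)
open import Data.Product using (_×_; _,_; proj₁; proj₂; ∃-syntax)
open import Data.Sum as Sum using (_⊎_; inj₁; inj₂)
open import Function using (_∘_; case_of_)
open import Relation.Binary.Definitions using (WeaklyDecidable)
open import Relation.Binary.PropositionalEquality as ≡ using (_≡_; _≢_)
open import Relation.Nullary using (¬_; yes; no)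
open import Relation.Nullary.Decidable using (decidable-stable)
open import Relation.Unary using (Pred; _⊆′_)

-- Algebra.Solver.Ring with integer coefficients, written as formal differences (a , b) of naturals.
-- With the ring's own elements as coefficients, x - x would not normalise to 0.
module DifferenceCoefficientSolver {c ℓ} (R : CommutativeRing c ℓ) where
  open CommutativeRing R
  open import Algebra.Properties.Ring ring using (-‿+-comm; -0#≈0#; ⁻¹-anti-homo‿-; x[y-z]≈xy-xz; [y-z]x≈yx-zx; x∙y⁻¹≈ε⇒x≈y)
  open import Algebra.Properties.CommutativeSemigroup +-commutativeSemigroup using (interchange)
  open import Algebra.Properties.Semiring.Mult semiring using (×-homo-+; ×1-homo-*) renaming (_×_ to _·ℕ_)
  open import Relation.Binary.Reasoning.Setoid setoid

  -‿interchange : ∀ x y z w → (x + y) - (z + w) ≈ (x - z) + (y - w)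
  -‿interchange x y z w = trans (+-congˡ (sym (-‿+-comm z w))) (interchange x y (- z) (- w))

  [x-y][z-w]≈[xz+yw]-[xw+yz] : ∀ x y z w → (x - y) * (z - w) ≈ (x * z + y * w) - (x * w + y * z)
  [x-y][z-w]≈[xz+yw]-[xw+yz] x y z w = begin
    (x - y) * (z - w)                      ≈⟨ [y-z]x≈yx-zx (z - w) x y ⟩
    x * (z - w) - y * (z - w)              ≈⟨ +-cong (x[y-z]≈xy-xz x z w) (-‿cong (x[y-z]≈xy-xz y z w)) ⟩
    (x * z - x * w) - (y * z - y * w)      ≈⟨ +-congˡ (⁻¹-anti-homo‿- (y * z) (y * w)) ⟩
    (x * z - x * w) + (y * w - y * z)      ≈⟨ -‿interchange (x * z) (y * w) (x * w) (y * z) ⟨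
    (x * z + y * w) - (x * w + y * z)      ∎

  x+w≈z+y⇒x-y≈z-w : ∀ {x y z w} → x + w ≈ z + y → x - y ≈ z - w
  x+w≈z+y⇒x-y≈z-w {x} {y} {z} {w} x+w≈z+y = x∙y⁻¹≈ε⇒x≈y (x - y) (z - w) (begin
    (x - y) - (z - w)   ≈⟨ +-congˡ (⁻¹-anti-homo‿- z w) ⟩
    (x - y) + (w - z)   ≈⟨ -‿interchange x w y z ⟨
    (x + w) - (y + z)   ≈⟨ +-cong x+w≈z+y (-‿cong (+-comm y z)) ⟩
    (z + y) - (z + y)   ≈⟨ -‿inverseʳ (z + y) ⟩
    0#                  ∎)

  ℕ² : RawRing 0ℓ 0ℓ
  ℕ² = record
    { Carrier = ℕ × ℕ
    ; _≈_     = _≡_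
    ; _+_     = λ { (a , b) (c , d) → (a ℕ.+ c , b ℕ.+ d) }
    ; _*_     = λ { (a , b) (c , d) → (a ℕ.* c ℕ.+ b ℕ.* d , a ℕ.* d ℕ.+ b ℕ.* c) }
    ; -_      = λ { (a , b) → (b , a) }
    ; 0#      = (0 , 0)
    ; 1#      = (1 , 0)
    }

  ⟦_⟧ : ℕ × ℕ → Carrier
  ⟦ a , b ⟧ = a ·ℕ 1# - b ·ℕ 1#

  ×1-homo-+* : ∀ a b c d → (a ℕ.* c ℕ.+ b ℕ.* d) ·ℕ 1# ≈ (a ·ℕ 1#) * (c ·ℕ 1#) + (b ·ℕ 1#) * (d ·ℕ 1#)
  ×1-homo-+* a b c d = trans (×-homo-+ 1# (a ℕ.* c) (b ℕ.* d)) (+-cong (×1-homo-* a c) (×1-homo-* b d))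

  ⟦⟧-homomorphism : ℕ² -Raw-AlmostCommutative⟶ fromCommutativeRing R
  ⟦⟧-homomorphism = record
    { ⟦_⟧    = ⟦_⟧
    ; +-homo = λ { (a , b) (c , d) →
        trans (+-cong (×-homo-+ 1# a c) (-‿cong (×-homo-+ 1# b d))) (-‿interchange _ _ _ _) }
    ; *-homo = λ { (a , b) (c , d) →
        trans (+-cong (×1-homo-+* a b c d) (-‿cong (×1-homo-+* a b d c))) (sym ([x-y][z-w]≈[xz+yw]-[xw+yz] _ _ _ _)) }
    ; -‿homo = λ { (a , b) → sym (⁻¹-anti-homo‿- (a ·ℕ 1#) (b ·ℕ 1#)) }
    ; 0-homo = -‿inverseʳ 0#
    ; 1-homo = trans (+-cong (+-identityʳ 1#) -0#≈0#) (+-identityʳ 1#)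
    }

  ⟦⟧-≈? : WeaklyDecidable (λ m n → ⟦ m ⟧ ≈ ⟦ n ⟧)
  ⟦⟧-≈? (a , b) (c , d) with a ℕ.+ d ℕ.≟ c ℕ.+ b
  ... | yes a+d≡c+b = just (x+w≈z+y⇒x-y≈z-w (trans (sym (×-homo-+ 1# a d)) (trans (reflexive (≡.cong (_·ℕ 1#) a+d≡c+b)) (×-homo-+ 1# c b))))
  ... | no _        = nothing

  open import Algebra.Solver.Ring ℕ² (fromCommutativeRing R) ⟦⟧-homomorphism ⟦⟧-≈? public
    using (solve; _:=_; _:+_; _:-_; _:*_)

module LocalRingProperties {c ℓ} (R : CommutativeRing c ℓ) where
  open CommutativeRing R hiding (zero)
  open RingNotions R
  open DifferenceCoefficientSolver R using (solve; _:=_; _:+_; _:-_; _:*_)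
  open import Algebra.Properties.Ring ring using (-1*x≈-x; x∙y⁻¹≈ε⇒x≈y)
  open import Algebra.Properties.Semiring.Mult semiring using (×1-homo-*)
  open import Algebra.Properties.CommutativeSemiring.Exp commutativeSemiring using (^-distrib-*)
  open import Relation.Binary.Reasoning.Setoid setoid

  L : Level
  L = c ⊔ ℓ

  ⟨_⟩ : Carrier → Pred Carrier L
  ⟨ a ⟩ y = ∃[ r ] (y ≈ r * a)

  ⟨⟩-isIdeal : ∀ a → IsIdeal ⟨ a ⟩
  ⟨⟩-isIdeal a = record
    { resp     = λ { y≈z (r , y≈ra) → r , trans (sym y≈z) y≈ra }
    ; has0     = 0# , sym (zeroˡ a)
    ; +-closed = λ { (r , y≈ra) (s , z≈sa) → r + s , trans (+-cong y≈ra z≈sa) (sym (distribʳ a r s)) }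
    ; *-closed = λ { t (r , y≈ra) → t * r , trans (*-congˡ y≈ra) (sym (*-assoc t r a)) }
    }

  1∈⟨⟩⇒unit : ∀ {a} → ⟨ a ⟩ 1# → IsUnit a
  1∈⟨⟩⇒unit {a} (r , 1≈ra) = r , trans (*-comm a r) (sym 1≈ra)

  module _ {I : Pred Carrier L} (I-ideal : IsIdeal I) where
    open IsIdeal I-ideal

    -‿closed : ∀ {x} → I x → I (- x)
    -‿closed {x} x∈I = resp (-1*x≈-x x) (*-closed (- 1#) x∈I)

    −-closed : ∀ {x y} → I x → I y → I (x - y)
    −-closed x∈I y∈I = +-closed x∈I (-‿closed y∈I)

    1∈⇒∈ : I 1# → ∀ x → I x
    1∈⇒∈ 1∈I x = resp (*-identityʳ x) (*-closed x 1∈I)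

    ·ℕ1-closed : ∀ m {k} → I (k ·ℕ 1#) → I ((m ℕ.* k) ·ℕ 1#)
    ·ℕ1-closed m {k} k∈I = resp (sym (×1-homo-* m k)) (*-closed (m ·ℕ 1#) k∈I)

    suc-·ℕ1⇒1∈ : ∀ {s t} → I (s ·ℕ 1#) → I (t ·ℕ 1#) → suc s ≡ t → I 1#
    suc-·ℕ1⇒1∈ {s} s∈I t∈I ≡.refl =
      resp (solve 2 (λ o x → (o :+ x) :- x := o) refl 1# (s ·ℕ 1#)) (−-closed t∈I s∈I)

    coprime-·ℕ1⇒1∈ : ∀ {m n} → Coprime m n → I (m ·ℕ 1#) → I (n ·ℕ 1#) → I 1#
    coprime-·ℕ1⇒1∈ {m} {n} m⊥n m∈I n∈I with coprime-Bézout m⊥n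
    ... | Bézout.+- x y 1+yn≡xm = suc-·ℕ1⇒1∈ (·ℕ1-closed y n∈I) (·ℕ1-closed x m∈I) 1+yn≡xm
    ... | Bézout.-+ x y 1+xm≡yn = suc-·ℕ1⇒1∈ (·ℕ1-closed x m∈I) (·ℕ1-closed y n∈I) 1+xm≡yn

  _+⟨_⟩ : Pred Carrier L → Carrier → Pred Carrier L
  (I +⟨ a ⟩) y = ∃[ r ] ∃[ i ] (I i × y ≈ i + r * a)

  module _ {I : Pred Carrier L} (I-ideal : IsIdeal I) (a : Carrier) where
    private module I = IsIdeal I-ideal

    +⟨⟩-isIdeal : IsIdeal (I +⟨ a ⟩)
    +⟨⟩-isIdeal = record
      { resp     = λ { y≈z (r , i , i∈I , y≈i+ra) → r , i , i∈I , trans (sym y≈z) y≈i+ra }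
      ; has0     = 0# , 0# , I.has0 , sym (trans (+-identityˡ (0# * a)) (zeroˡ a))
      ; +-closed = λ { (r , i , i∈I , y≈i+ra) (s , j , j∈I , z≈j+sa) →
          r + s , i + j , I.+-closed i∈I j∈I ,
          trans (+-cong y≈i+ra z≈j+sa) (solve 5 (λ i r j s a → (i :+ r :* a) :+ (j :+ s :* a) := (i :+ j) :+ (r :+ s) :* a) refl i r j s a) }
      ; *-closed = λ { t (r , i , i∈I , y≈i+ra) →
          t * r , t * i , I.*-closed t i∈I ,
          trans (*-congˡ y≈i+ra) (solve 4 (λ t i r a → t :* (i :+ r :* a) := t :* i :+ (t :* r) :* a) refl t i r a) }
      }

    ⊆+⟨⟩ : I ⊆′ I +⟨ a ⟩
    ⊆+⟨⟩ x x∈I = 0# , x , x∈I , sym (trans (+-congˡ (zeroˡ a)) (+-identityʳ x))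

    ∈+⟨⟩ : (I +⟨ a ⟩) a
    ∈+⟨⟩ = 1# , 0# , I.has0 , sym (trans (+-identityˡ (1# * a)) (*-identityˡ a))

    +⟨⟩-least : ∀ {J} → IsIdeal J → I ⊆′ J → J a → I +⟨ a ⟩ ⊆′ J
    +⟨⟩-least J-ideal I⊆J a∈J x (r , i , i∈I , x≈i+ra) =
      J.resp (sym x≈i+ra) (J.+-closed (I⊆J i i∈I) (J.*-closed r a∈J))
      where module J = IsIdeal J-ideal

  ∪-const-isIdeal : ∀ {I} → IsIdeal I → (Q : Set L) → IsIdeal (λ x → I x ⊎ Q)
  ∪-const-isIdeal I-ideal Q = record
    { resp     = λ y≈z → Sum.map₁ (I.resp y≈z)
    ; has0     = inj₁ I.has0
    ; +-closed = λ { (inj₁ y∈I) (inj₁ z∈I) → inj₁ (I.+-closed y∈I z∈I) ; (inj₁ _) (inj₂ q) → inj₂ q ; (inj₂ q) _ → inj₂ q }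
    ; *-closed = λ r → Sum.map₁ (I.*-closed r)
    }
    where module I = IsIdeal I-ideal

  module _ {M} (M-max : IsMaximalIdeal M) where
    open IsMaximalIdeal M-max

    -- Maximality is stated against every predicate of level c ⊔ ℓ, in particular against the
    -- ideal M ∪ (R if Q); so comparing the two decides Q.
    maximal⇒excludedMiddle : ExcludedMiddle L
    maximal⇒excludedMiddle {Q} with maximal (λ x → M x ⊎ Q) (∪-const-isIdeal isIdeal Q) (λ _ → inj₁)
    ... | inj₁ M∪Q⊆M    = no (λ q → proper (M∪Q⊆M 1# (inj₂ q)))
    ... | inj₂ M∪Q-full = Sum.[ ⊥-elim ∘ proper , yes ] (M∪Q-full 1#)

  module Saturation (em : ExcludedMiddle L) where

    grow : Pred Carrier L → Carrier → Pred Carrier L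
    grow I a with em {(I +⟨ a ⟩) 1#}
    ... | yes _ = I
    ... | no  _ = I +⟨ a ⟩

    module _ {I : Pred Carrier L} (I-ideal : IsIdeal I) (a : Carrier) where

      grow-isIdeal : IsIdeal (grow I a)
      grow-isIdeal with em {(I +⟨ a ⟩) 1#}
      ... | yes _ = I-ideal
      ... | no  _ = +⟨⟩-isIdeal I-ideal a

      ⊆grow : I ⊆′ grow I a
      ⊆grow with em {(I +⟨ a ⟩) 1#}
      ... | yes _ = λ _ x∈I → x∈I
      ... | no  _ = ⊆+⟨⟩ I-ideal a

      grow-proper : ¬ I 1# → ¬ grow I a 1#
      grow-proper 1∉I with em {(I +⟨ a ⟩) 1#}
      ... | yes _      = 1∉I
      ... | no 1∉I+⟨a⟩ = 1∉I+⟨a⟩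

      grow-absorbs : ∀ {J} → IsIdeal J → grow I a ⊆′ J → ¬ J 1# → J a → grow I a a
      grow-absorbs J-ideal grow⊆J 1∉J a∈J with em {(I +⟨ a ⟩) 1#}
      ... | yes 1∈I+⟨a⟩ = ⊥-elim (1∉J (+⟨⟩-least I-ideal a J-ideal grow⊆J a∈J 1# 1∈I+⟨a⟩))
      ... | no  _       = ∈+⟨⟩ I-ideal a

    saturate : ∀ {n} → Pred Carrier L → (Fin n → Carrier) → Pred Carrier L
    saturate {zero}  I f = I
    saturate {suc n} I f = saturate (grow I (f zero)) (f ∘ suc)

    saturate-isIdeal : ∀ {n I} (f : Fin n → Carrier) → IsIdeal I → IsIdeal (saturate I f)
    saturate-isIdeal {zero}  f I-ideal = I-ideal
    saturate-isIdeal {suc n} f I-ideal = saturate-isIdeal (f ∘ suc) (grow-isIdeal I-ideal (f zero))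

    ⊆saturate : ∀ {n I} (f : Fin n → Carrier) → IsIdeal I → I ⊆′ saturate I f
    ⊆saturate {zero}  f I-ideal = λ _ x∈I → x∈I
    ⊆saturate {suc n} f I-ideal x x∈I =
      ⊆saturate (f ∘ suc) (grow-isIdeal I-ideal (f zero)) x (⊆grow I-ideal (f zero) x x∈I)

    saturate-proper : ∀ {n I} (f : Fin n → Carrier) → IsIdeal I → ¬ I 1# → ¬ saturate I f 1#
    saturate-proper {zero}  f I-ideal 1∉I = 1∉I
    saturate-proper {suc n} f I-ideal 1∉I =
      saturate-proper (f ∘ suc) (grow-isIdeal I-ideal (f zero)) (grow-proper I-ideal (f zero) 1∉I)

    saturate-absorbs : ∀ {n I J} (f : Fin n → Carrier) → IsIdeal I → IsIdeal J →
                       saturate I f ⊆′ J → ¬ J 1# → ∀ i → J (f i) → saturate I f (f i)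
    saturate-absorbs {suc n} f I-ideal J-ideal sat⊆J 1∉J zero fi∈J =
      ⊆saturate (f ∘ suc) grow-ideal (f zero)
        (grow-absorbs I-ideal (f zero) J-ideal (λ x → sat⊆J x ∘ ⊆saturate (f ∘ suc) grow-ideal x) 1∉J fi∈J)
      where
      grow-ideal : IsIdeal (grow _ (f zero))
      grow-ideal = grow-isIdeal I-ideal (f zero)
    saturate-absorbs {suc n} f I-ideal J-ideal sat⊆J 1∉J (suc i) fi∈J =
      saturate-absorbs (f ∘ suc) (grow-isIdeal I-ideal (f zero)) J-ideal sat⊆J 1∉J i fi∈J

    -- Adjoining the elements of an enumeration of R one at a time, whenever this keeps the
    -- ideal proper, ends in a maximal ideal.
    maximalIdealAbove : IsFinite → ∀ {I} → IsIdeal I → ¬ I 1# → ∃[ N ] (IsMaximalIdeal N × I ⊆′ N)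
    maximalIdealAbove (n , f , f-surjective) {I} I-ideal 1∉I =
      saturate I f , N-maximal , ⊆saturate f I-ideal
      where
      N-ideal : IsIdeal (saturate I f)
      N-ideal = saturate-isIdeal f I-ideal
      module N = IsIdeal N-ideal

      N-maximal : IsMaximalIdeal (saturate I f)
      N-maximal = record
        { isIdeal = N-ideal
        ; proper  = saturate-proper f I-ideal 1∉I
        ; maximal = λ J J-ideal N⊆J → let module J = IsIdeal J-ideal in case em {J 1#} of λ where
            (yes 1∈J) → inj₂ (1∈⇒∈ J-ideal 1∈J)
            (no 1∉J)  → inj₁ (λ x x∈J → let i , fi≈x = f-surjective x in
              N.resp fi≈x (saturate-absorbs f I-ideal J-ideal N⊆J 1∉J i (J.resp (sym fi≈x) x∈J)))
        }

  module _ {M : Pred Carrier L} (M-max : IsMaximalIdeal M) where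
    open IsMaximalIdeal M-max

    residueChar≢p⇒p·1∉M : ∀ {p} → Prime p → (∀ q → ResidueCharIs M q → q ≢ p) → ¬ M (p ·ℕ 1#)
    residueChar≢p⇒p·1∉M {p} p-prime char≢p p∈M =
      char≢p p (ℕ.>-nonZero⁻¹ p {{prime⇒nonZero p-prime}} , p∈M , k∉M) ≡.refl
      where
      k∉M : ∀ k → 0 ℕ.< k → k ℕ.< p → ¬ M (k ·ℕ 1#)
      k∉M k 0<k k<p k∈M =
        proper (coprime-·ℕ1⇒1∈ isIdeal (prime⇒coprime p-prime {{ℕ.>-nonZero 0<k}} k<p) p∈M k∈M)

    module _ (fin : IsFinite) (local : IsLocal) where
      open Saturation (maximal⇒excludedMiddle M-max)

      nonunit⇒∈M : ∀ {x} → ¬ IsUnit x → M x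
      nonunit⇒∈M {x} x-nonunit =
        let N , N-max , ⟨x⟩⊆N = maximalIdealAbove fin (⟨⟩-isIdeal x) (x-nonunit ∘ 1∈⟨⟩⇒unit)
            _ , _ , unique    = local
        in proj₂ (unique M M-max) x (proj₁ (unique N N-max) x (⟨x⟩⊆N x (1# , sym (*-identityˡ x))))

      ∉M⇒unit : ∀ {x} → ¬ M x → IsUnit x
      ∉M⇒unit x∉M = decidable-stable (maximal⇒excludedMiddle M-max) (x∉M ∘ nonunit⇒∈M)

  geometricSum : Carrier → Carrier → ℕ → Carrier
  geometricSum u v zero    = 0#
  geometricSum u v (suc k) = u ^ k + v * geometricSum u v k

  uᵏ-vᵏ≈[u-v]*geometricSum : ∀ u v k → u ^ k - v ^ k ≈ (u - v) * geometricSum u v k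
  uᵏ-vᵏ≈[u-v]*geometricSum u v zero    = trans (-‿inverseʳ 1#) (sym (zeroʳ (u - v)))
  uᵏ-vᵏ≈[u-v]*geometricSum u v (suc k) = begin
    u * u ^ k - v * v ^ k
      ≈⟨ solve 4 (λ u v a b → u :* a :- v :* b := (u :- v) :* a :+ v :* (a :- b)) refl u v (u ^ k) (v ^ k) ⟩
    (u - v) * u ^ k + v * (u ^ k - v ^ k)
      ≈⟨ +-congˡ (*-congˡ (uᵏ-vᵏ≈[u-v]*geometricSum u v k)) ⟩
    (u - v) * u ^ k + v * ((u - v) * S)
      ≈⟨ solve 4 (λ u v a s → (u :- v) :* a :+ v :* ((u :- v) :* s) := (u :- v) :* (a :+ v :* s)) refl u v (u ^ k) S ⟩
    (u - v) * (u ^ k + v * S) ∎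
    where
    S : Carrier
    S = geometricSum u v k

  unit-resp-≈ : ∀ {x y} → x ≈ y → IsUnit x → IsUnit y
  unit-resp-≈ x≈y (x′ , xx′≈1) = x′ , trans (*-congʳ (sym x≈y)) xx′≈1

  unit-*-closed : ∀ {x y} → IsUnit x → IsUnit y → IsUnit (x * y)
  unit-*-closed {x} {y} (x′ , xx′≈1) (y′ , yy′≈1) = x′ * y′ , (begin
    (x * y) * (x′ * y′) ≈⟨ solve 4 (λ x y x′ y′ → (x :* y) :* (x′ :* y′) := (x :* x′) :* (y :* y′)) refl x y x′ y′ ⟩
    (x * x′) * (y * y′) ≈⟨ *-cong xx′≈1 yy′≈1 ⟩
    1# * 1#             ≈⟨ *-identityˡ 1# ⟩
    1#                  ∎)

  unit-^-closed : ∀ {x} → IsUnit x → ∀ k → IsUnit (x ^ k)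
  unit-^-closed x-unit zero    = 1# , *-identityˡ 1#
  unit-^-closed x-unit (suc k) = unit-*-closed x-unit (unit-^-closed x-unit k)

  x*unit≈0⇒x≈0 : ∀ {x s} → IsUnit s → x * s ≈ 0# → x ≈ 0#
  x*unit≈0⇒x≈0 {x} {s} (s′ , ss′≈1) xs≈0 = begin
    x             ≈⟨ *-identityʳ x ⟨
    x * 1#        ≈⟨ *-congˡ ss′≈1 ⟨
    x * (s * s′)  ≈⟨ *-assoc x s s′ ⟨
    (x * s) * s′  ≈⟨ *-congʳ xs≈0 ⟩
    0# * s′       ≈⟨ zeroˡ s′ ⟩
    0#            ∎

  UnitPthPower : ℕ → Pred Carrier L
  UnitPthPower p z = ∃[ u ] (IsUnit u × u ^ p ≈ z)

  module _ {p : ℕ} where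

    UnitPthPower-resp-≈ : ∀ {z z′} → z ≈ z′ → UnitPthPower p z → UnitPthPower p z′
    UnitPthPower-resp-≈ z≈z′ (u , u-unit , uᵖ≈z) = u , u-unit , trans uᵖ≈z z≈z′

    UnitPthPower⇒unit : ∀ {z} → UnitPthPower p z → IsUnit z
    UnitPthPower⇒unit (u , u-unit , uᵖ≈z) = unit-resp-≈ uᵖ≈z (unit-^-closed u-unit p)

    UnitPthPower-*-closed : ∀ {z t} → UnitPthPower p z → UnitPthPower p t → UnitPthPower p (z * t)
    UnitPthPower-*-closed (u , u-unit , uᵖ≈z) (v , v-unit , vᵖ≈t) =
      u * v , unit-*-closed u-unit v-unit , trans (^-distrib-* u v p) (*-cong uᵖ≈z vᵖ≈t)

  finite⇒injectiveOn⇒surjectiveOn : IsFinite → (f : Carrier → Carrier) {P : Pred Carrier L} →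
    (∀ {x} → P x → P (f x)) → (∀ {x y} → P x → P y → f x ≈ f y → x ≈ y) →
    ∀ {t} → P t → ∃[ v ] (P v × f v ≈ t)
  finite⇒injectiveOn⇒surjectiveOn (n , enum , enum-surjective) f {P} f-closed f-injective {t} t∈P =
    let i , j , i<j , indexᵢ≡indexⱼ = pigeonhole (n<1+n n) index
    in preimage-from-cycle i<j (begin
      orbit (toℕ i)  ≈⟨ proj₂ (enum-surjective (orbit (toℕ i))) ⟨
      enum (index i) ≡⟨ ≡.cong enum indexᵢ≡indexⱼ ⟩
      enum (index j) ≈⟨ proj₂ (enum-surjective (orbit (toℕ j))) ⟩
      orbit (toℕ j)  ∎)
    where
    orbit : ℕ → Carrier
    orbit = fold t f

    orbit∈P : ∀ k → P (orbit k)
    orbit∈P zero    = t∈P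
    orbit∈P (suc k) = f-closed (orbit∈P k)

    preimage-from-cycle : ∀ {i j} → i ℕ.< j → orbit i ≈ orbit j → ∃[ v ] (P v × f v ≈ t)
    preimage-from-cycle {zero}  {suc j} _         t≈fⱼ = orbit j , orbit∈P j , sym t≈fⱼ
    preimage-from-cycle {suc i} {suc j} (s≤s i<j) fᵢ≈fⱼ =
      preimage-from-cycle i<j (f-injective (orbit∈P i) (orbit∈P j) fᵢ≈fⱼ)

    index : Fin (suc n) → Fin n
    index k = proj₁ (enum-surjective (orbit (toℕ k)))

  module OnePlus {M : Pred Carrier L} (M-ideal : IsIdeal M) where
    open IsIdeal M-ideal

    1+M : Pred Carrier L
    1+M u = M (u - 1#)

    1∈1+M : 1+M 1#
    1∈1+M = resp (sym (-‿inverseʳ 1#)) has0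

    1+M-*-closed : ∀ {u v} → 1+M u → 1+M v → 1+M (u * v)
    1+M-*-closed {u} {v} u∈1+M v∈1+M =
      resp (sym (solve 3 (λ u v o → u :* v :- o := u :* (v :- o) :+ (u :* o :- o)) refl u v 1#))
           (+-closed (*-closed u v∈1+M) (resp (+-congʳ (sym (*-identityʳ u))) u∈1+M))

    1+M-^-closed : ∀ {u} → 1+M u → ∀ k → 1+M (u ^ k)
    1+M-^-closed u∈1+M zero    = 1∈1+M
    1+M-^-closed u∈1+M (suc k) = 1+M-*-closed u∈1+M (1+M-^-closed u∈1+M k)

    1+M-disjoint : ¬ M 1# → ∀ {u} → 1+M u → ¬ M u
    1+M-disjoint 1∉M {u} u∈1+M u∈M =
      1∉M (resp (solve 2 (λ u o → u :- (u :- o) := o) refl u 1#) (−-closed M-ideal u∈M u∈1+M))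

    geometricSum-on-1+M : ∀ {u v} → 1+M u → 1+M v → ∀ k → M (geometricSum u v k - k ·ℕ 1#)
    geometricSum-on-1+M u∈1+M v∈1+M zero    = resp (sym (-‿inverseʳ 0#)) has0
    geometricSum-on-1+M {u} {v} u∈1+M v∈1+M (suc k) =
      resp (sym (solve 5 (λ a v s o n → (a :+ v :* s) :- (o :+ n) := (a :- o) :+ ((v :- o) :* s :+ (o :* s :- n)))
                   refl (u ^ k) v S 1# (k ·ℕ 1#)))
        (+-closed (1+M-^-closed u∈1+M k)
          (+-closed (resp (*-comm S (v - 1#)) (*-closed S v∈1+M))
                    (resp (+-congʳ (sym (*-identityˡ S))) (geometricSum-on-1+M u∈1+M v∈1+M k))))
      where
      S : Carrier
      S = geometricSum u v k

    module _ (p : ℕ) (p·1∉M : ¬ M (p ·ℕ 1#)) (∉M⇒unit : ∀ {x} → ¬ M x → IsUnit x) where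

      ^-injectiveOn-1+M : ∀ {u v} → 1+M u → 1+M v → u ^ p ≈ v ^ p → u ≈ v
      ^-injectiveOn-1+M {u} {v} u∈1+M v∈1+M uᵖ≈vᵖ = x∙y⁻¹≈ε⇒x≈y u v (x*unit≈0⇒x≈0 (∉M⇒unit S∉M) [u-v]S≈0)
        where
        S : Carrier
        S = geometricSum u v p

        S∉M : ¬ M S
        S∉M S∈M = p·1∉M (resp (solve 2 (λ s n → s :- (s :- n) := n) refl S (p ·ℕ 1#))
                               (−-closed M-ideal S∈M (geometricSum-on-1+M u∈1+M v∈1+M p)))

        [u-v]S≈0 : (u - v) * S ≈ 0#
        [u-v]S≈0 = trans (sym (uᵏ-vᵏ≈[u-v]*geometricSum u v p)) (trans (+-congʳ uᵖ≈vᵖ) (-‿inverseʳ (v ^ p)))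

      1+M⊆UnitPthPower : IsFinite → 1+M ⊆′ UnitPthPower p
      1+M⊆UnitPthPower fin t t∈1+M =
        let v , v∈1+M , vᵖ≈t = finite⇒injectiveOn⇒surjectiveOn fin (_^ p) (λ u∈1+M → 1+M-^-closed u∈1+M p)
                                 ^-injectiveOn-1+M t∈1+M
        in v , ∉M⇒unit (1+M-disjoint (λ 1∈M → p·1∉M (1∈⇒∈ M-ideal 1∈M (p ·ℕ 1#))) v∈1+M) , vᵖ≈t

    module _ (p : ℕ) (pthRoots : 1+M ⊆′ UnitPthPower p) where

      -- z + m = z (1 + z⁻¹ m), and the second factor lies in 1+M.
      UnitPthPower-+M-invariant : ∀ {z m} → UnitPthPower p z → M m → UnitPthPower p (z + m)
      UnitPthPower-+M-invariant {z} {m} z-power m∈M =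
        UnitPthPower-resp-≈ {p} z[1+z′m]≈z+m (UnitPthPower-*-closed {p} z-power (pthRoots _ 1+z′m∈1+M))
        where
        z′ : Carrier
        z′ = proj₁ (UnitPthPower⇒unit {p} z-power)

        zz′≈1 : z * z′ ≈ 1#
        zz′≈1 = proj₂ (UnitPthPower⇒unit {p} z-power)

        1+z′m∈1+M : 1+M (1# + z′ * m)
        1+z′m∈1+M = resp (sym (solve 2 (λ o x → (o :+ x) :- o := x) refl 1# (z′ * m))) (*-closed z′ m∈M)

        z[1+z′m]≈z+m : z * (1# + z′ * m) ≈ z + m
        z[1+z′m]≈z+m = begin
          z * (1# + z′ * m)      ≈⟨ solve 4 (λ z o z′ m → z :* (o :+ z′ :* m) := z :* o :+ (z :* z′) :* m) refl z 1# z′ m ⟩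
          z * 1# + (z * z′) * m  ≈⟨ +-cong (*-identityʳ z) (trans (*-congʳ zz′≈1) (*-identityˡ m)) ⟩
          z + m                  ∎

      Adj-resp-M : ∀ {w x y} → Adj p w x → M x → M y → Adj p w y
      Adj-resp-M {w} {x} {y} w~x x∈M y∈M =
        UnitPthPower-resp-≈ {p} (solve 3 (λ w x y → (w :- x) :+ (x :- y) := w :- y) refl w x y)
                            (UnitPthPower-+M-invariant w~x (−-closed M-ideal x∈M y∈M))

      M-homogeneous : ExcludedMiddle L → G.IsHomogeneous p M
      M-homogeneous em w _ with em {Adj p w 0#}
      ... | yes w~0 = inj₁ (λ x x∈M → Adj-resp-M w~0 has0 x∈M)
      ... | no  w≁0 = inj₂ (λ x x∈M w~x → w≁0 (Adj-resp-M w~x x∈M has0))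

proposition3p1 : {c ℓ : Level} (p : ℕ) → Prime p → (R : CommutativeRing c ℓ) →
    let open RingNotions R in
    IsFinite → IsLocal → (M : Pred (CommutativeRing.Carrier R) _) → IsMaximalIdeal M →
    (∀ q → ResidueCharIs M q → q ≢ p) → MinusOneIsPthPower p →
    G.IsHomogeneous p M × (G.IsPrimeGraph p → IsField)
proposition3p1 p p-prime R fin local M M-max char≢p _ = homogeneous , prime⇒field
  where
  open CommutativeRing R
  open RingNotions R
  open LocalRingProperties R
  open IsMaximalIdeal M-max
  open IsIdeal isIdeal
  open OnePlus isIdeal

  ∉M⇒unit′ : ∀ {x} → ¬ M x → IsUnit x
  ∉M⇒unit′ = ∉M⇒unit M-max fin local

  homogeneous : G.IsHomogeneous p M
  homogeneous = M-homogeneous p (1+M⊆UnitPthPower p (residueChar≢p⇒p·1∉M M-max p-prime char≢p) ∉M⇒unit′ fin)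
                              (maximal⇒excludedMiddle M-max)

  prime⇒field : G.IsPrimeGraph p → IsField
  prime⇒field prime = (λ 1≈0 → proper (resp (sym 1≈0) has0)) ,
    λ x x≉0 → ∉M⇒unit′ (λ x∈M → prime M resp homogeneous ((x , 0# , x∈M , has0 , x≉0) , 1# , proper))
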